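{- Let $\mathcal{A}$ be a deterministic parity automaton with state set $Q$, and let $\equiv_{state}$ be the equivalence on nonempty finite strings over $Q$ defined in the context. Then: (1) $\equiv_{state}$ has finitely many equivalence classes; (2) $\equiv_{state}$ is a congruence with respect to concatenation: if $u_1\equiv_{state}v_1$ and $u_2\equiv_{state}v_2$ then $u_1u_2\equiv_{state}v_1v_2$; (3) for every $\omega$-string $\pi$ over $Q$ there are nonempty finite strings $u_0,u_1,\dots$ such that $\pi=u_0u_1\cdots u_n\cdots$, $u_i\equiv_{state}u_j\equiv_{state}u_iu_{i+1}$ for all $i,j>0$, and $u_0\equiv_{state}u_0u_1$.
   Context: A deterministic parity automaton is $\mathcal{A}=(Q,\Sigma,\delta,q_{init},pr)$ with finite state set $Q$, finite alphabet $\Sigma$, transition function $\delta:Q\times\Sigma\to Q$, initial state $q_{init}$ and priority function $pr:Q\to\mathbb{N}$. A string $q_0q_1\cdots$ (finite or infinite) over $Q$ is a run of $\mathcal{A}$ if for each consecutive pair $q_i,q_{i+1}$ there is $\sigma\in\Sigma$ with $q_{i+1}=\delta(q_i,\sigma)$. For a string $u$, $u[n]$ denotes its $n$-th letter (positions start at $0$) and $u[k,m)$ denotes the set of letters $\{u[i]: k\le i<m\}$. For nonempty finite strings $u,v$ over $Q$, $u\equiv_{state}v$ iff: (i) $u$ and $v$ have the same first letter and the same last letter; (ii) for every position $m$ of $u$ there is a position $n$ of $v$ with $u[m]=v[n]$ and $u[0,m)=v[0,n)$; (iii) symmetrically, for every position $n$ of $v$ there is a position $m$ of $u$ with $u[m]=v[n]$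 and $u[0,m)=v[0,n)$; (iv) $u$ is a run of $\mathcal{A}$ iff $v$ is a run of $\mathcal{A}$. -}

module Defs where

open import Data.Nat using (ℕ; zero; suc; _+_; _>_)
open import Data.Fin using (Fin; toℕ)
open import Data.List using (List; []; _∷_; take; lookup)
open import Data.List.NonEmpty using (List⁺; toList; head; last; _⁺++⁺_)
import Data.List.NonEmpty as L⁺
open import Data.List.Membership.Propositional using (_∈_)
open import Data.List.Relation.Unary.Any using (Any)
open import Data.Product using (Σ; ∃; ∃-syntax; _×_; _,_)
open import Data.Unit using (⊤)
open import Relation.Binary.PropositionalEquality using (_≡_)

record DPA : Set where
  field
    nQ    : ℕ
    nΣ    : ℕ
    δ     : Fin nQ → Fin nΣ → Fin nQ
    qinit : Fin nQ
    pr    : Fin nQ → ℕ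

module _ (𝒜 : DPA) where
  open DPA 𝒜

  Q : Set
  Q = Fin nQ

  IsRun : List Q → Set
  IsRun []             = ⊤
  IsRun (q ∷ [])       = ⊤
  IsRun (q ∷ q′ ∷ qs)  = (∃[ σ ] δ q σ ≡ q′) × IsRun (q′ ∷ qs)

  SameSet : List Q → List Q → Set
  SameSet xs ys = ∀ q → (q ∈ xs → q ∈ ys) × (q ∈ ys → q ∈ xs)

  PosMatch : (u v : List Q) → Fin (Data.List.length u) → Fin (Data.List.length v) → Set
  PosMatch u v m n = (lookup u m ≡ lookup v n) × SameSet (take (toℕ m) u) (take (toℕ n) v)

  _≡state_ : List⁺ Q → List⁺ Q → Set
  u ≡state v =
      (head u ≡ head v × last u ≡ last v)
    × (∀ m → ∃[ n ] PosMatch (toList u) (toList v) m n)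
    × (∀ n → ∃[ m ] PosMatch (toList u) (toList v) m n)
    × ((IsRun (toList u) → IsRun (toList v)) × (IsRun (toList v) → IsRun (toList u)))

  FiniteIndex : Set
  FiniteIndex = Σ (List (List⁺ Q)) λ reps → ∀ u → Any (u ≡state_) reps

-- Concatenation u₀u₁u₂⋯ of an ω-sequence of nonempty strings:
-- start i is the position in the ω-string where block u i begins.
start : {A : Set} → (ℕ → List⁺ A) → ℕ → ℕ
start u zero    = 0
start u (suc i) = start u i + L⁺.length (u i)

IsInfConcat : {A : Set} → (ℕ → A) → (ℕ → List⁺ A) → Set
IsInfConcat π u =
  ∀ i (j : Fin (Data.List.length (toList (u i)))) →
    π (start u i + toℕ j) ≡ lookup (toList (u i)) j

module Submission where

-- The ≡state-class of a string is determined by finitely many Boolean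
-- features: its first and last letter, whether it is a run, and which pairs
-- (letter, set of earlier letters) occur at its positions. Read as bits they
-- give a code into a finite set whose fibres are exactly the classes.
-- Congruence holds because the positions of u₁u₂ are those of u₁ together
-- with those of u₂ with the letters of u₁ added to their prefixes, and a run
-- of u₁u₂ is a run of u₁, one transition and a run of u₂. Pigeonhole on the
-- codes of prefixes shortens every string to an equivalent one of bounded
-- length, so there are finitely many classes. For the factorisation, colour
-- a < b by the code of π[a, b); Ramsey's theorem (by excluded middle) gives
-- infinitely many cut points between any two of which the blocks share one
-- code, and two adjacent such blocks concatenate to another one.

open import Defs
open import Axiom.ExcludedMiddle using (ExcludedMiddle)
open import Data.Bool as Bool using (Bool; true; false)
open import Data.Empty using (⊥-elim)
open import Data.Fin as Fin using (Fin; toℕ; combine)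
open import Data.Fin.Properties using (combine-injective; 2↔Bool; any?; pigeonhole; toℕ≤pred[n])
open import Data.Fin.Subset using (Subset)
open import Data.List as L using (List; []; _∷_; _++_; length; take; drop; lookup; applyUpTo; cartesianProductWith)
open import Data.List.Extrema.Nat using (max; xs≤max)
import Data.List.Membership.DecPropositional as DecMembership
open import Data.List.Membership.Propositional using (_∈_; find; lose)
open import Data.List.Membership.Propositional.Properties
  using (∈-tabulate⁺; ∈-cartesianProductWith⁺; ∈-allFin; ∈-lookup; ∈-map⁺; ∈-map⁻
        ; ∈-++⁻; ∈-++⁺ˡ; ∈-++⁺ʳ)
open import Data.List.NonEmpty as L⁺ using (List⁺; _∷_; _⁺++⁺_; _⁺++_; toList; head; last)
open import Data.List.Properties
  using (length-applyUpTo; lookup-applyUpTo; map-id; map-++; map-∘; ++-identityʳ; take++drop≡id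
        ; length-++; length-take; length-drop)
open import Data.List.Relation.Binary.Subset.Propositional using (_⊆_)
import Data.List.Relation.Binary.Subset.Propositional.Properties as ⊆
open import Data.List.Relation.Unary.All as All using (All; []; _∷_)
open import Data.List.Relation.Unary.Any as Any using (Any; here; there; index)
open import Data.List.Relation.Unary.Any.Properties using (lookup-index; ++⁺ˡ; ++⁺ʳ; map⁺)
open import Data.Nat using (ℕ; zero; suc; _+_; _∸_; _⊓_; _^_; _≤_; _<_; _>_; _≤?_; z≤n; s≤s)
open import Data.Nat.Induction using (<-wellFounded)
open import Data.Nat.Properties
open import Data.Product using (Σ; ∃-syntax; _×_; _,_; proj₁; proj₂; map; map₂; swap)
import Data.Product.Properties as ×
open import Data.Sum using (inj₁; inj₂)
open import Data.Unit using (⊤; tt)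
import Data.Vec as V
open import Data.Vec.Properties as Vec using (tabulate-cong; lookup∘tabulate)
open import Function using (_∘_; id; Injection)
open import Function.Bundles using (mk⇔)
open import Function.Properties.Inverse using (↔-sym; ↔⇒↣)
open import Induction.WellFounded using (Acc; acc)
open import Level using (0ℓ)
open import Relation.Binary.Core using (_Preserves_⟶_)
open import Relation.Binary.PropositionalEquality
open import Relation.Nullary using (¬_; Dec; yes; no; does)
open import Relation.Nullary.Decidable using (_×-dec_; does-⇔)

private
  variable
    A I : Set
    n : ℕ

applyUpTo-++ : ∀ (f : ℕ → A) m n →
               applyUpTo f (m + n) ≡ applyUpTo f m ++ applyUpTo (λ k → f (m + k)) n
applyUpTo-++ f zero    n = refl
applyUpTo-++ f (suc m) n = cong (f 0 ∷_) (applyUpTo-++ (f ∘ suc) m n)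

applyUpTo-cong : ∀ {f g : ℕ → A} → (∀ k → f k ≡ g k) → ∀ n → applyUpTo f n ≡ applyUpTo g n
applyUpTo-cong f≗g zero    = refl
applyUpTo-cong f≗g (suc n) = cong₂ _∷_ (f≗g 0) (applyUpTo-cong (f≗g ∘ suc) n)

-- The block f a ∷ … ∷ f (b ∸ 1); for b ≤ a it degenerates to f a ∷ [].
-- The head is written f (a + 0) so that the underlying list is literally
-- applyUpTo (λ k → f (a + k)) (suc (b ∸ suc a)).
interval : (ℕ → A) → ℕ → ℕ → List⁺ A
interval f a b = f (a + 0) ∷ applyUpTo (λ k → f (a + suc k)) (b ∸ suc a)

lookup-interval : ∀ (f : ℕ → A) a b j → lookup (toList (interval f a b)) j ≡ f (a + toℕ j)
lookup-interval f a b = lookup-applyUpTo (λ k → f (a + k)) (suc (b ∸ suc a))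

interval-++ : ∀ (f : ℕ → A) {a b c} → a < b → b < c →
              interval f a b ⁺++⁺ interval f b c ≡ interval f a c
interval-++ f {a} {b} {c} a<b b<c = cong (f (a + 0) ∷_) (begin
    applyUpTo F d ++ applyUpTo (λ k → f (b + k)) (suc e)
  ≡⟨ cong (applyUpTo F d ++_) (applyUpTo-cong shift (suc e)) ⟨
    applyUpTo F d ++ applyUpTo (λ k → F (d + k)) (suc e)
  ≡⟨ applyUpTo-++ F d (suc e) ⟨
    applyUpTo F (d + suc e)
  ≡⟨ cong (applyUpTo F) d+1+e≡c∸1+a ⟩
    applyUpTo F (c ∸ suc a) ∎)
  where
  open ≡-Reasoning
  F : ℕ → _
  F k = f (a + suc k)
  d = b ∸ suc a
  e = c ∸ suc b
  1+a+d≡b : suc a + d ≡ b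
  1+a+d≡b = m+[n∸m]≡n a<b
  shift : ∀ k → F (d + k) ≡ f (b + k)
  shift k = cong f (trans (+-suc a (d + k)) (trans (sym (+-assoc (suc a) d k)) (cong (_+ k) 1+a+d≡b)))
  1+a+[d+1+e]≡c : suc a + (d + suc e) ≡ c
  1+a+[d+1+e]≡c = trans (sym (+-assoc (suc a) d (suc e)))
                 (trans (cong (_+ suc e) 1+a+d≡b) (trans (+-suc b e) (m+[n∸m]≡n b<c)))
  d+1+e≡c∸1+a : d + suc e ≡ c ∸ suc a
  d+1+e≡c∸1+a = trans (sym (m+n∸m≡n (suc a) (d + suc e))) (cong (_∸ suc a) 1+a+[d+1+e]≡c)

interval-length : ∀ (f : ℕ → A) {a b} → a < b → a + L⁺.length (interval f a b) ≡ b
interval-length f {a} {b} a<b = begin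
  a + suc (length (applyUpTo (λ k → f (a + suc k)) (b ∸ suc a)))
    ≡⟨ cong (λ n → a + suc n) (length-applyUpTo _ (b ∸ suc a)) ⟩
  a + suc (b ∸ suc a)   ≡⟨ +-suc a (b ∸ suc a) ⟩
  suc a + (b ∸ suc a)   ≡⟨ m+[n∸m]≡n a<b ⟩
  b                     ∎
  where open ≡-Reasoning

lastOf : A → List A → A
lastOf x []       = x
lastOf x (y ∷ ys) = lastOf y ys

last≡lastOf : ∀ (x : A) xs → last (x ∷ xs) ≡ lastOf x xs
last≡lastOf x xs with L.initLast xs
... | []            = refl
... | ys L.∷ʳ′ y = sym (lastOf-∷ʳ x ys)
  where
  lastOf-∷ʳ : ∀ x ys → lastOf x (ys L.∷ʳ y) ≡ y
  lastOf-∷ʳ x []       = refl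
  lastOf-∷ʳ x (z ∷ zs) = lastOf-∷ʳ z zs

last-⁺++⁺ : ∀ (u v : List⁺ A) → last (u ⁺++⁺ v) ≡ last v
last-⁺++⁺ (x ∷ xs) (y ∷ ys) = begin
  last (x ∷ xs ++ y ∷ ys)  ≡⟨ last≡lastOf x (xs ++ y ∷ ys) ⟩
  lastOf x (xs ++ y ∷ ys)  ≡⟨ lastOf-++ x xs ⟩
  lastOf y ys              ≡⟨ last≡lastOf y ys ⟨
  last (y ∷ ys)            ∎
  where
  open ≡-Reasoning
  lastOf-++ : ∀ x xs → lastOf x (xs ++ y ∷ ys) ≡ lastOf y ys
  lastOf-++ x []       = refl
  lastOf-++ x (z ∷ zs) = lastOf-++ z zs

listsUpTo : List A → ℕ → List (List A)
listsUpTo as zero    = [] ∷ []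
listsUpTo as (suc n) = [] ∷ cartesianProductWith _∷_ as (listsUpTo as n)

∈-listsUpTo : ∀ {as xs : List A} → All (_∈ as) xs → length xs ≤ n → xs ∈ listsUpTo as n
∈-listsUpTo {n = zero}  []           _         = here refl
∈-listsUpTo {n = suc n} []           _         = here refl
∈-listsUpTo {n = suc n} (x∈as ∷ xs⊆) (s≤s len) =
  there (∈-cartesianProductWith⁺ _∷_ x∈as (∈-listsUpTo xs⊆ len))

allSubsets : ∀ n → List (Subset n)
allSubsets zero    = V.[] ∷ []
allSubsets (suc n) = cartesianProductWith V._∷_ (true ∷ false ∷ []) (allSubsets n)

∈-allSubsets : ∀ (p : Subset n) → p ∈ allSubsets n
∈-allSubsets V.[]       = here refl
∈-allSubsets (b V.∷ p) = ∈-cartesianProductWith⁺ V._∷_ (∈-bools b) (∈-allSubsets p)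
  where
  ∈-bools : ∀ b → b ∈ true ∷ false ∷ []
  ∈-bools true  = here refl
  ∈-bools false = there (here refl)

does≡⇒ : ∀ {P R : Set} (p? : Dec P) (r? : Dec R) → does p? ≡ does r? → P → R
does≡⇒ p?      (yes r) _  _ = r
does≡⇒ (no ¬p) (no _)  _  p = ⊥-elim (¬p p)

bit : Bool → Fin 2
bit = Injection.to (↔⇒↣ (↔-sym 2↔Bool))

bit-injective : ∀ {b c} → bit b ≡ bit c → b ≡ c
bit-injective = Injection.injective (↔⇒↣ (↔-sym 2↔Bool))

signature : (I → A → Bool) → (is : List I) → A → Fin (2 ^ length is)
signature t []       x = Fin.zero
signature t (i ∷ is) x = combine (bit (t i x)) (signature t is x)

signature-injective : ∀ (t : I → A → Bool) is {x y} →
                      signature t is x ≡ signature t is y → All (λ i → t i x ≡ t i y) is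
signature-injective t []       eq = []
signature-injective t (i ∷ is) eq with combine-injective _ _ _ _ eq
... | bits≡ , rest≡ = bit-injective bits≡ ∷ signature-injective t is rest≡

signature-cong : ∀ (t : I → A → Bool) is {x y} →
                 All (λ i → t i x ≡ t i y) is → signature t is x ≡ signature t is y
signature-cong t []       []            = refl
signature-cong t (i ∷ is) (t≡ ∷ rest≡) = cong₂ (λ b → combine (bit b)) t≡ (signature-cong t is rest≡)

Infinite : (ℕ → Set) → Set
Infinite X = ∀ n → ∃[ m ] n ≤ m × X m

stepwise⇒increasing : ∀ {h : ℕ → ℕ} → (∀ t → h t < h (suc t)) → h Preserves _<_ ⟶ _<_
stepwise⇒increasing {h} step {s} {suc t} (s≤s s≤t) with m≤n⇒m<n∨m≡n s≤t
... | inj₁ s<t  = <-trans (stepwise⇒increasing step s<t) (step t)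
... | inj₂ refl = step t

enumerate : ∀ {X} → Infinite X → ∃[ h ] h Preserves _<_ ⟶ _<_ × (∀ t → X (h t))
enumerate {X} inf = h , stepwise⇒increasing (λ t → proj₁ (proj₂ (inf (suc (h t))))) , h∈X
  where
  h : ℕ → ℕ
  h zero    = proj₁ (inf 0)
  h (suc t) = proj₁ (inf (suc (h t)))
  h∈X : ∀ t → X (h t)
  h∈X zero    = proj₂ (proj₂ (inf 0))
  h∈X (suc t) = proj₂ (proj₂ (inf (suc (h t))))

module Ramsey (em : ExcludedMiddle 0ℓ) where

  eventuallyNot : ∀ {X} → ¬ Infinite X → ∃[ n ] ∀ m → n ≤ m → ¬ X m
  eventuallyNot {X} finite with em {∃[ n ] ∀ m → n ≤ m → ¬ X m}
  ... | yes bound = bound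
  ... | no unbounded = ⊥-elim (finite infinite)
    where
    infinite : Infinite X
    infinite n with em {∃[ m ] n ≤ m × X m}
    ... | yes found = found
    ... | no none   = ⊥-elim (unbounded (n , λ m n≤m x → none (m , n≤m , x)))

  infinitePigeonhole : ∀ {M X} → Infinite X → (c : ℕ → Fin M) →
                       ∃[ k ] Infinite (λ m → X m × c m ≡ k)
  infinitePigeonhole {M} {X} inf c with em {∃[ k ] Infinite (λ m → X m × c m ≡ k)}
  ... | yes found   = found
  ... | no noColour = ⊥-elim (beyond (proj₂ (proj₂ (inf N)) , refl))
    where
    threshold : Fin M → ℕ
    threshold k = proj₁ (eventuallyNot (λ infₖ → noColour (k , infₖ)))
    N = max 0 (L.tabulate threshold)
    far = proj₁ (inf N)
    threshold≤N : threshold (c far) ≤ N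
    threshold≤N = All.lookup (xs≤max 0 (L.tabulate threshold)) (∈-tabulate⁺ (c far))
    beyond : ¬ (X far × c far ≡ c far)
    beyond = proj₂ (eventuallyNot _) far (≤-trans threshold≤N (proj₁ (proj₂ (inf N))))

  -- The usual construction: pick a pivot, keep the later elements whose
  -- edge to the pivot has the majority colour, and repeat; the pivots have
  -- colours depending only on the earlier endpoint, and a second
  -- pigeonhole makes that colour constant.
  module _ {M} (col : ℕ → ℕ → Fin M) where

    record InfiniteSet : Set₁ where
      field
        member   : ℕ → Set
        infinite : Infinite member

      pivot : ℕ
      pivot = proj₁ (infinite 0)

      pivot∈ : member pivot
      pivot∈ = proj₂ (proj₂ (infinite 0))

      later : Infinite (λ m → member m × pivot < m)
      later n = let m , n+1+p≤m , m∈ = infinite (n + suc pivot) in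
        m , ≤-trans (m≤m+n n (suc pivot)) n+1+p≤m , m∈ , ≤-trans (m≤n+m (suc pivot) n) n+1+p≤m

      majority : ∃[ k ] Infinite (λ m → (member m × pivot < m) × col pivot m ≡ k)
      majority = infinitePigeonhole later (col pivot)

      colour : Fin M
      colour = proj₁ majority

      refine : InfiniteSet
      refine = record { infinite = proj₂ majority }

    open InfiniteSet

    stages : InfiniteSet → ℕ → InfiniteSet
    stages S zero    = S
    stages S (suc i) = refine (stages S i)

    stages-decreasing : ∀ S {i j m} → i ≤ j → member (stages S j) m → member (stages S i) m
    stages-decreasing S {j = zero}  z≤n    m∈ = m∈
    stages-decreasing S {i} {suc j} i≤1+j m∈ with m≤n⇒m<n∨m≡n i≤1+j
    ... | inj₁ i<1+j = stages-decreasing S (≤-pred i<1+j) (proj₁ (proj₁ m∈))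
    ... | inj₂ refl  = m∈

    pivots-prehomogeneous : ∀ S {i j} → i < j →
                  pivot (stages S i) < pivot (stages S j)
                  × col (pivot (stages S i)) (pivot (stages S j)) ≡ colour (stages S i)
    pivots-prehomogeneous S {i} {j} i<j with stages-decreasing S i<j (pivot∈ (stages S j))
    ... | (_ , p<q) , colour≡ = p<q , colour≡

    ramsey : ∀ {X} → Infinite X →
             ∃[ h ] h Preserves _<_ ⟶ _<_ × (∀ t → X (h t))
                    × ∃[ c ] ∀ {s t} → s < t → col (h s) (h t) ≡ c
    ramsey {X} inf =
        pivots , (λ s<t → proj₁ (pivots-prehomogeneous S (idx-increasing s<t)))
      , (λ t → stages-decreasing S {j = idx t} z≤n (pivot∈ (stages S (idx t))))
      , c , λ {s} s<t → trans (proj₂ (pivots-prehomogeneous S (idx-increasing s<t))) (idx-colour s)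
      where
      S : InfiniteSet
      S = record { member = X ; infinite = inf }
      pivotColours : ∃[ c ] Infinite (λ i → ⊤ × colour (stages S i) ≡ c)
      pivotColours = infinitePigeonhole (λ n → n , ≤-refl , tt) (λ i → colour (stages S i))
      c : Fin M
      c = proj₁ pivotColours
      enumerated : ∃[ idx ] idx Preserves _<_ ⟶ _<_ × (∀ t → ⊤ × colour (stages S (idx t)) ≡ c)
      enumerated = enumerate (proj₂ pivotColours)
      idx : ℕ → ℕ
      idx = proj₁ enumerated
      idx-increasing : idx Preserves _<_ ⟶ _<_
      idx-increasing = proj₁ (proj₂ enumerated)
      idx-colour : ∀ t → colour (stages S (idx t)) ≡ c
      idx-colour t = proj₂ (proj₂ (proj₂ enumerated) t)
      pivots : ℕ → ℕ
      pivots t = pivot (stages S (idx t))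

module StateEquivalence (𝒜 : DPA) where
  open DPA 𝒜 using (nQ; δ)

  private
    variable
      x y : Q 𝒜
      xs xs′ ys ys′ : List (Q 𝒜)
      u u′ v v′ : List⁺ (Q 𝒜)

  SameSet-sym : SameSet 𝒜 xs ys → SameSet 𝒜 ys xs
  SameSet-sym same q = swap (same q)

  SameSet-++ : SameSet 𝒜 xs xs′ → SameSet 𝒜 ys ys′ → SameSet 𝒜 (xs ++ ys) (xs′ ++ ys′)
  SameSet-++ sameˣ sameʸ q =
    ⊆.++⁺ (proj₁ (sameˣ _)) (proj₁ (sameʸ _)) , ⊆.++⁺ (proj₂ (sameˣ _)) (proj₂ (sameʸ _))

  PosMatch-sym : ∀ {m n} → PosMatch 𝒜 xs ys m n → PosMatch 𝒜 ys xs n m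
  PosMatch-sym (letter≡ , prefix≡) = sym letter≡ , SameSet-sym prefix≡

  position : ∀ xs → Fin (length xs) → Q 𝒜 × List (Q 𝒜)
  position xs m = lookup xs m , take (toℕ m) xs

  positions : List (Q 𝒜) → List (Q 𝒜 × List (Q 𝒜))
  positions []       = []
  positions (x ∷ xs) = (x , []) ∷ L.map (map₂ (x ∷_)) (positions xs)

  ∈-positions⁺ : ∀ xs m → position xs m ∈ positions xs
  ∈-positions⁺ (x ∷ xs) Fin.zero    = here refl
  ∈-positions⁺ (x ∷ xs) (Fin.suc m) = there (∈-map⁺ (map₂ (x ∷_)) (∈-positions⁺ xs m))

  ∈-positions⁻ : ∀ xs {p} → p ∈ positions xs → ∃[ m ] p ≡ position xs m
  ∈-positions⁻ (x ∷ xs) (here refl) = Fin.zero , refl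
  ∈-positions⁻ (x ∷ xs) (there p∈) with ∈-map⁻ (map₂ (x ∷_)) p∈
  ... | _ , p∈′ , refl with ∈-positions⁻ xs p∈′
  ...   | m , refl = Fin.suc m , refl

  positions-++ : ∀ xs ys → positions (xs ++ ys) ≡ positions xs ++ L.map (map₂ (xs ++_)) (positions ys)
  positions-++ []       ys = sym (map-id (positions ys))
  positions-++ (x ∷ xs) ys = cong ((x , []) ∷_) (begin
    L.map (map₂ (x ∷_)) (positions (xs ++ ys))
      ≡⟨ cong (L.map (map₂ (x ∷_))) (positions-++ xs ys) ⟩
    L.map (map₂ (x ∷_)) (positions xs ++ L.map (map₂ (xs ++_)) (positions ys))
      ≡⟨ map-++ (map₂ (x ∷_)) (positions xs) _ ⟩
    L.map (map₂ (x ∷_)) (positions xs) ++ L.map (map₂ (x ∷_)) (L.map (map₂ (xs ++_)) (positions ys))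
      ≡⟨ cong (L.map (map₂ (x ∷_)) (positions xs) ++_) (map-∘ (positions ys)) ⟨
    L.map (map₂ (x ∷_)) (positions xs) ++ L.map (map₂ ((x ∷ xs) ++_)) (positions ys) ∎)
    where open ≡-Reasoning

  Matches : (p q : Q 𝒜 × List (Q 𝒜)) → Set
  Matches (x , xs) (y , ys) = x ≡ y × SameSet 𝒜 xs ys

  MatchedIn : List (Q 𝒜) → List (Q 𝒜) → Set
  MatchedIn xs ys = ∀ {p} → p ∈ positions xs → Any (Matches p) (positions ys)

  posMatch⇒matchedIn : (∀ m → ∃[ n ] PosMatch 𝒜 xs ys m n) → MatchedIn xs ys
  posMatch⇒matchedIn {xs} {ys} match p∈ with ∈-positions⁻ xs p∈
  ... | m , refl = lose (∈-positions⁺ ys (proj₁ (match m))) (proj₂ (match m))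

  matchedIn⇒posMatch : MatchedIn xs ys → ∀ m → ∃[ n ] PosMatch 𝒜 xs ys m n
  matchedIn⇒posMatch {xs} {ys} matched m with find (matched (∈-positions⁺ xs m))
  ... | _ , q∈ , match with ∈-positions⁻ ys q∈
  ...   | n , refl = n , match

  matchedIn⇒⊆ : MatchedIn xs ys → xs ⊆ ys
  matchedIn⇒⊆ {xs} {ys} matched q∈xs with matchedIn⇒posMatch matched (index q∈xs)
  ... | n , letter≡ , _ = subst (_∈ ys) (sym (trans (lookup-index q∈xs) letter≡)) (∈-lookup n)

  matchedIn-++ : MatchedIn xs xs′ → SameSet 𝒜 xs xs′ → MatchedIn ys ys′ →
                 MatchedIn (xs ++ ys) (xs′ ++ ys′)
  matchedIn-++ {xs} {xs′} {ys} {ys′} matchedˣ sameˣ matchedʸ p∈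
    rewrite positions-++ xs′ ys′ with ∈-++⁻ (positions xs) (subst (_ ∈_) (positions-++ xs ys) p∈)
  ... | inj₁ p∈ˣ = ++⁺ˡ (matchedˣ p∈ˣ)
  ... | inj₂ p∈ʸ with ∈-map⁻ (map₂ (xs ++_)) p∈ʸ
  ...   | _ , p∈ʸ′ , refl =
    ++⁺ʳ (positions xs′) (map⁺ (Any.map (map₂ (SameSet-++ sameˣ)) (matchedʸ p∈ʸ′)))

  record _≈_ (u v : List⁺ (Q 𝒜)) : Set where
    field
      head≡    : head u ≡ head v
      last≡    : last u ≡ last v
      matchedʳ : MatchedIn (toList u) (toList v)
      matchedˡ : MatchedIn (toList v) (toList u)
      run⇒     : IsRun 𝒜 (toList u) → IsRun 𝒜 (toList v)
      run⇐     : IsRun 𝒜 (toList v) → IsRun 𝒜 (toList u)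

    sameLetters : SameSet 𝒜 (toList u) (toList v)
    sameLetters q = matchedIn⇒⊆ matchedʳ , matchedIn⇒⊆ matchedˡ

  open _≈_

  ≡state⇒≈ : _≡state_ 𝒜 u v → u ≈ v
  ≡state⇒≈ ((head≡ , last≡) , matchʳ , matchˡ , run⇒ , run⇐) = record
    { head≡    = head≡
    ; last≡    = last≡
    ; matchedʳ = posMatch⇒matchedIn matchʳ
    ; matchedˡ = posMatch⇒matchedIn (λ n → let m , match = matchˡ n in m , PosMatch-sym match)
    ; run⇒     = run⇒
    ; run⇐     = run⇐
    }

  ≈⇒≡state : u ≈ v → _≡state_ 𝒜 u v
  ≈⇒≡state u≈v =
      (head≡ u≈v , last≡ u≈v)
    , matchedIn⇒posMatch (matchedʳ u≈v)
    , (λ n → let m , match = matchedIn⇒posMatch (matchedˡ u≈v) n in m , PosMatch-sym match)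
    , run⇒ u≈v , run⇐ u≈v

  ≈-refl : u ≈ u
  ≈-refl = record
    { head≡ = refl ; last≡ = refl
    ; matchedʳ = λ p∈ → lose p∈ (refl , λ q → id , id)
    ; matchedˡ = λ p∈ → lose p∈ (refl , λ q → id , id)
    ; run⇒ = id ; run⇐ = id
    }

  ≈-sym : u ≈ v → v ≈ u
  ≈-sym u≈v = record
    { head≡ = sym (head≡ u≈v) ; last≡ = sym (last≡ u≈v)
    ; matchedʳ = matchedˡ u≈v ; matchedˡ = matchedʳ u≈v
    ; run⇒ = run⇐ u≈v ; run⇐ = run⇒ u≈v
    }

  Step : Q 𝒜 → Q 𝒜 → Set
  Step p q = ∃[ σ ] δ p σ ≡ q

  run-⁺++⁺⁻ : ∀ u v → IsRun 𝒜 (toList (u ⁺++⁺ v)) →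
              IsRun 𝒜 (toList u) × Step (last u) (head v) × IsRun 𝒜 (toList v)
  run-⁺++⁺⁻ (x ∷ xs) (y ∷ ys) run =
    let runᵘ , join , runᵛ = split x xs run
    in  runᵘ , subst (λ q → Step q y) (sym (last≡lastOf x xs)) join , runᵛ
    where
    split : ∀ x xs → IsRun 𝒜 (x ∷ xs ++ y ∷ ys) →
            IsRun 𝒜 (x ∷ xs) × Step (lastOf x xs) y × IsRun 𝒜 (y ∷ ys)
    split x []       (step , run) = tt , step , run
    split x (z ∷ zs) (step , run) = let runᵘ , join , runᵛ = split z zs run in (step , runᵘ) , join , runᵛ

  run-⁺++⁺⁺ : ∀ u v → IsRun 𝒜 (toList u) → Step (last u) (head v) → IsRun 𝒜 (toList v) →
              IsRun 𝒜 (toList (u ⁺++⁺ v))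
  run-⁺++⁺⁺ (x ∷ xs) (y ∷ ys) runᵘ join runᵛ =
    glue x xs runᵘ (subst (λ q → Step q y) (last≡lastOf x xs) join)
    where
    glue : ∀ x xs → IsRun 𝒜 (x ∷ xs) → Step (lastOf x xs) y → IsRun 𝒜 (x ∷ xs ++ y ∷ ys)
    glue x []       _             join = join , runᵛ
    glue x (z ∷ zs) (step , runᶻ) join = step , glue z zs runᶻ join

  run-⁺++⁺-cong : u ≈ u′ → v ≈ v′ →
                  IsRun 𝒜 (toList (u ⁺++⁺ v)) → IsRun 𝒜 (toList (u′ ⁺++⁺ v′))
  run-⁺++⁺-cong {u} {u′} {v} {v′} u≈u′ v≈v′ run =
    let runᵘ , join , runᵛ = run-⁺++⁺⁻ u v run
    in  run-⁺++⁺⁺ u′ v′ (run⇒ u≈u′ runᵘ) (subst₂ Step (last≡ u≈u′) (head≡ v≈v′) join)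
                  (run⇒ v≈v′ runᵛ)

  ≈-⁺++⁺ : u ≈ u′ → v ≈ v′ → (u ⁺++⁺ v) ≈ (u′ ⁺++⁺ v′)
  ≈-⁺++⁺ {x ∷ xs} {x′ ∷ xs′} {v} {v′} u≈u′ v≈v′ = record
    { head≡    = head≡ u≈u′
    ; last≡    = trans (last-⁺++⁺ (x ∷ xs) v)
                       (trans (last≡ v≈v′) (sym (last-⁺++⁺ (x′ ∷ xs′) v′)))
    ; matchedʳ = matchedIn-++ (matchedʳ u≈u′) (sameLetters u≈u′) (matchedʳ v≈v′)
    ; matchedˡ = matchedIn-++ (matchedˡ u≈u′) (SameSet-sym (sameLetters u≈u′)) (matchedˡ v≈v′)
    ; run⇒     = run-⁺++⁺-cong u≈u′ v≈v′
    ; run⇐     = run-⁺++⁺-cong (≈-sym u≈u′) (≈-sym v≈v′)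
    }

  open DecMembership {A = Q 𝒜} Fin._≟_ using (_∈?_)

  letterSet : List (Q 𝒜) → Subset nQ
  letterSet xs = V.tabulate (λ q → does (q ∈? xs))

  letterSet-cong : SameSet 𝒜 xs ys → letterSet xs ≡ letterSet ys
  letterSet-cong same =
    tabulate-cong (λ q → does-⇔ (mk⇔ (proj₁ (same q)) (proj₂ (same q))) (q ∈? _) (q ∈? _))

  letterSet-injective : letterSet xs ≡ letterSet ys → SameSet 𝒜 xs ys
  letterSet-injective {xs} {ys} eq q =
    does≡⇒ (q ∈? xs) (q ∈? ys) does≡ , does≡⇒ (q ∈? ys) (q ∈? xs) (sym does≡)
    where
    does≡ : does (q ∈? xs) ≡ does (q ∈? ys)
    does≡ = trans (sym (lookup∘tabulate _ q)) (trans (cong (λ s → V.lookup s q) eq) (lookup∘tabulate _ q))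

  profile : List (Q 𝒜) → List (Q 𝒜 × Subset nQ)
  profile xs = L.map (map₂ letterSet) (positions xs)

  data Feature : Set where
    startsWith endsWith : Q 𝒜 → Feature
    isRun               : Feature
    hasPosition         : Q 𝒜 → Subset nQ → Feature

  _⊨_ : List⁺ (Q 𝒜) → Feature → Set
  u ⊨ startsWith q    = head u ≡ q
  u ⊨ endsWith q      = last u ≡ q
  u ⊨ isRun           = IsRun 𝒜 (toList u)
  u ⊨ hasPosition q A = (q , A) ∈ profile (toList u)

  isRun? : ∀ xs → Dec (IsRun 𝒜 xs)
  isRun? []           = yes tt
  isRun? (x ∷ [])     = yes tt
  isRun? (x ∷ y ∷ ys) = any? (λ σ → δ x σ Fin.≟ y) ×-dec isRun? (y ∷ ys)

  _⊨?_ : ∀ u f → Dec (u ⊨ f)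
  u ⊨? startsWith q    = head u Fin.≟ q
  u ⊨? endsWith q      = last u Fin.≟ q
  u ⊨? isRun           = isRun? (toList u)
  u ⊨? hasPosition q A = (q , A) ∈ₚ? profile (toList u)
    where open DecMembership (×.≡-dec Fin._≟_ (Vec.≡-dec Bool._≟_)) renaming (_∈?_ to _∈ₚ?_)

  states : List (Q 𝒜)
  states = L.allFin nQ

  features : List Feature
  features = L.map startsWith states ++ L.map endsWith states
          ++ isRun ∷ cartesianProductWith hasPosition states (allSubsets nQ)

  ∈-features : ∀ f → f ∈ features
  ∈-features (startsWith q)    = ∈-++⁺ˡ (∈-map⁺ startsWith (∈-allFin q))
  ∈-features (endsWith q)      = ∈-++⁺ʳ (L.map startsWith states) (∈-++⁺ˡ (∈-map⁺ endsWith (∈-allFin q)))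
  ∈-features isRun             = ∈-++⁺ʳ (L.map startsWith states) (∈-++⁺ʳ (L.map endsWith states) (here refl))
  ∈-features (hasPosition q A) = ∈-++⁺ʳ (L.map startsWith states) (∈-++⁺ʳ (L.map endsWith states)
    (there (∈-cartesianProductWith⁺ hasPosition (∈-allFin q) (∈-allSubsets A))))

  ≈⇒⊨ : u ≈ v → ∀ f → u ⊨ f → v ⊨ f
  ≈⇒⊨ u≈v (startsWith q)    = trans (sym (head≡ u≈v))
  ≈⇒⊨ u≈v (endsWith q)      = trans (sym (last≡ u≈v))
  ≈⇒⊨ u≈v isRun             = run⇒ u≈v
  ≈⇒⊨ u≈v (hasPosition q A) qA∈ with ∈-map⁻ (map₂ letterSet) qA∈
  ... | p , p∈ , refl with find (matchedʳ u≈v p∈)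
  ...   | p′ , p′∈ , letter≡ , prefix≡ =
    subst (_∈ _) (sym (cong₂ _,_ letter≡ (letterSet-cong prefix≡))) (∈-map⁺ (map₂ letterSet) p′∈)

  ⊨⇒matchedIn : (∀ f → u ⊨ f → v ⊨ f) → MatchedIn (toList u) (toList v)
  ⊨⇒matchedIn transfer {p} p∈
    with ∈-map⁻ (map₂ letterSet) (transfer (hasPosition _ _) (∈-map⁺ (map₂ letterSet) p∈))
  ... | p′ , p′∈ , eq = lose p′∈ (cong proj₁ eq , letterSet-injective (cong proj₂ eq))

  ⊨⇒≈ : (∀ f → u ⊨ f → v ⊨ f) → (∀ f → v ⊨ f → u ⊨ f) → u ≈ v
  ⊨⇒≈ {u} {v} to from = record
    { head≡    = sym (to (startsWith (head u)) refl)
    ; last≡    = sym (to (endsWith (last u)) refl)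
    ; matchedʳ = ⊨⇒matchedIn to
    ; matchedˡ = ⊨⇒matchedIn from
    ; run⇒     = to isRun
    ; run⇐     = from isRun
    }

  #codes : ℕ
  #codes = 2 ^ length features

  code : List⁺ (Q 𝒜) → Fin #codes
  code = signature (λ f u → does (u ⊨? f)) features

  ≈⇒code≡ : u ≈ v → code u ≡ code v
  ≈⇒code≡ {u} {v} u≈v = signature-cong _ features (All.tabulate λ {f} _ →
    does-⇔ (mk⇔ (≈⇒⊨ u≈v f) (≈⇒⊨ (≈-sym u≈v) f)) (u ⊨? f) (v ⊨? f))

  code≡⇒≈ : code u ≡ code v → u ≈ v
  code≡⇒≈ {u} {v} code≡ =
    ⊨⇒≈ (λ f → does≡⇒ (u ⊨? f) (v ⊨? f) (agree f)) (λ f → does≡⇒ (v ⊨? f) (u ⊨? f) (sym (agree f)))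
    where
    agree : ∀ f → does (u ⊨? f) ≡ does (v ⊨? f)
    agree f = All.lookup (signature-injective _ features code≡) (∈-features f)

  ≈-⁺++ : u ≈ v → ∀ w → (u ⁺++ w) ≈ (v ⁺++ w)
  ≈-⁺++ {x ∷ xs} {y ∷ ys} u≈v [] rewrite ++-identityʳ xs | ++-identityʳ ys = u≈v
  ≈-⁺++ {x ∷ xs} {y ∷ ys} u≈v (z ∷ zs) = ≈-⁺++⁺ u≈v ≈-refl

  -- Two of the #codes + 1 shortest prefixes share a code, and by congruence
  -- the part between them can be cut out.
  shorter : #codes < length xs → ∃[ ys ] length ys < length xs × code (x ∷ ys) ≡ code (x ∷ xs)
  shorter {xs} {x} long = pumped , pumped<xs , code≡
    where
    prefixCode : Fin (suc #codes) → Fin #codes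
    prefixCode i = code (x ∷ take (toℕ i) xs)
    collision = pigeonhole ≤-refl prefixCode
    i = toℕ (proj₁ collision)
    j = toℕ (proj₁ (proj₂ collision))
    i<j : i < j
    i<j = proj₁ (proj₂ (proj₂ collision))
    pumped = take i xs ++ drop j xs
    code≡ : code (x ∷ pumped) ≡ code (x ∷ xs)
    code≡ = trans (≈⇒code≡ (≈-⁺++ (code≡⇒≈ (proj₂ (proj₂ (proj₂ collision)))) (drop j xs)))
                  (cong (λ zs → code (x ∷ zs)) (take++drop≡id j xs))
    j≤length : j ≤ length xs
    j≤length = ≤-trans (toℕ≤pred[n] (proj₁ (proj₂ collision))) (<⇒≤ long)
    pumped<xs : length pumped < length xs
    pumped<xs = begin-strict
      length (take i xs ++ drop j xs)          ≡⟨ length-++ (take i xs) ⟩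
      length (take i xs) + length (drop j xs)  ≡⟨ cong₂ _+_ (length-take i xs) (length-drop j xs) ⟩
      (i ⊓ length xs) + (length xs ∸ j)         ≤⟨ +-monoˡ-≤ (length xs ∸ j) (m⊓n≤m i (length xs)) ⟩
      i + (length xs ∸ j)                       <⟨ +-monoˡ-< (length xs ∸ j) i<j ⟩
      j + (length xs ∸ j)                       ≡⟨ m+[n∸m]≡n j≤length ⟩
      length xs                                 ∎
      where open ≤-Reasoning

  shorten : ∀ x xs → ∃[ ys ] length ys ≤ #codes × code (x ∷ ys) ≡ code (x ∷ xs)
  shorten x xs = go xs (<-wellFounded (length xs))
    where
    go : ∀ xs → Acc _<_ (length xs) → ∃[ ys ] length ys ≤ #codes × code (x ∷ ys) ≡ code (x ∷ xs)
    go xs (acc smaller) with length xs ≤? #codes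
    ... | yes short = xs , short , refl
    ... | no long with shorter (≰⇒> long)
    ...   | ys , ys<xs , code≡ =
      let zs , short , code≡′ = go ys (smaller ys<xs) in zs , short , trans code≡′ code≡

  finiteIndex : FiniteIndex 𝒜
  finiteIndex = representatives , λ { (x ∷ xs) → represented x xs }
    where
    representatives = cartesianProductWith _∷_ states (listsUpTo states #codes)
    represented : ∀ x xs → Any (_≡state_ 𝒜 (x ∷ xs)) representatives
    represented x xs with shorten x xs
    ... | ys , short , code≡ = lose
      (∈-cartesianProductWith⁺ _∷_ (∈-allFin x) (∈-listsUpTo (All.tabulate λ {q} _ → ∈-allFin q) short))
      (≈⇒≡state (code≡⇒≈ (sym code≡)))

  module Factorisation (π : ℕ → Q 𝒜) (h : ℕ → ℕ) (h-increasing : h Preserves _<_ ⟶ _<_)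
                       (h-positive : ∀ t → 0 < h t) (c : Fin #codes)
                       (homogeneous : ∀ {s t} → s < t → code (interval π (h s) (h t)) ≡ c) where

    ≈-homogeneous : ∀ {s t s′ t′} → s < t → s′ < t′ → interval π (h s) (h t) ≈ interval π (h s′) (h t′)
    ≈-homogeneous s<t s′<t′ = code≡⇒≈ (trans (homogeneous s<t) (sym (homogeneous s′<t′)))

    -- h 0 is not a cut point: factor 0 = π[0, h 0) π[h 0, h 1) and
    -- factor 0 factor 1 = π[0, h 0) π[h 0, h 2) then agree by homogeneity.
    cut : ℕ → ℕ
    cut zero    = 0
    cut (suc i) = h (suc i)

    cut-increasing : ∀ i → cut i < cut (suc i)
    cut-increasing zero    = <-trans (h-positive 0) (h-increasing ≤-refl)
    cut-increasing (suc i) = h-increasing ≤-refl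

    factor : ℕ → List⁺ (Q 𝒜)
    factor i = interval π (cut i) (cut (suc i))

    start-factor : ∀ i → start factor i ≡ cut i
    start-factor zero    = refl
    start-factor (suc i) = trans (cong (_+ L⁺.length (factor i)) (start-factor i))
                                 (interval-length π (cut-increasing i))

    π≡concat : IsInfConcat π factor
    π≡concat i j =
      trans (cong (λ s → π (s + toℕ j)) (start-factor i)) (sym (lookup-interval π (cut i) (cut (suc i)) j))

    factors-equivalent : ∀ i j → i > 0 → j > 0 →
                         factor i ≈ factor j × factor i ≈ (factor i ⁺++⁺ factor (suc i))
    factors-equivalent (suc i) (suc j) _ _ =
        ≈-homogeneous ≤-refl ≤-refl
      , subst (factor (suc i) ≈_) (sym (interval-++ π (h-increasing ≤-refl) (h-increasing ≤-refl)))
              (≈-homogeneous ≤-refl (n≤1+n _))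

    first-absorbs : factor 0 ≈ (factor 0 ⁺++⁺ factor 1)
    first-absorbs = subst₂ _≈_
      (interval-++ π (h-positive 0) (h-increasing ≤-refl))
      (trans (interval-++ π (h-positive 0) (h-increasing (n≤1+n _)))
             (sym (interval-++ π (cut-increasing 0) (cut-increasing 1))))
      (≈-⁺++⁺ ≈-refl (≈-homogeneous ≤-refl (n≤1+n _)))

lemma5p6 : (𝒜 : DPA) →
    FiniteIndex 𝒜
    × (∀ u₁ v₁ u₂ v₂ → _≡state_ 𝒜 u₁ v₁ → _≡state_ 𝒜 u₂ v₂ →
         _≡state_ 𝒜 (u₁ ⁺++⁺ u₂) (v₁ ⁺++⁺ v₂))
    × (ExcludedMiddle 0ℓ →
         (π : ℕ → Q 𝒜) →
         Σ (ℕ → List⁺ (Q 𝒜)) λ u →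
           IsInfConcat π u
           × (∀ i j → i > 0 → j > 0 →
                _≡state_ 𝒜 (u i) (u j) × _≡state_ 𝒜 (u i) (u i ⁺++⁺ u (suc i)))
           × _≡state_ 𝒜 (u 0) (u 0 ⁺++⁺ u 1))
lemma5p6 𝒜 =
    finiteIndex
  , (λ _ _ _ _ u₁≡v₁ u₂≡v₂ → ≈⇒≡state (≈-⁺++⁺ (≡state⇒≈ u₁≡v₁) (≡state⇒≈ u₂≡v₂)))
  , λ em π →
      let h , h-increasing , h-positive , c , homogeneous =
            Ramsey.ramsey em (λ a b → code (interval π a b)) {X = 0 <_} (λ n → suc n , n≤1+n n , s≤s z≤n)
          open Factorisation π h h-increasing h-positive c homogeneous
      in  factor , π≡concat
        , (λ i j i>0 j>0 → map ≈⇒≡state ≈⇒≡state (factors-equivalent i j i>0 j>0))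
        , ≈⇒≡state first-absorbs
  where open StateEquivalence 𝒜
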